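{- There is an absolute constant $C$ such that the following holds. Let $G$ be a graph with $m=|E(G)|\ge 1$ edges, and let $G'$, $L$, $\alpha$, $\beta$ be constructed from $G$ as described in the context (for any admissible choices in the construction). If $G$ is 3-colorable, then there exists an $L$-recoloring sequence for $G'$ from $\alpha$ to $\beta$ of length at most $C\cdot m$.
   Context: Write $[4]=\{1,2,3,4\}$. For a graph $H$ and list assignment $L$ with $L(x)\subseteq[4]$, an $L$-coloring is a proper coloring $\gamma$ with $\gamma(x)\in L(x)$ for all $x$; an $L$-recoloring sequence of length $m$ is a sequence of $L$-colorings $\gamma_0,\dots,\gamma_m$ where consecutive colorings are equal or differ on exactly one vertex. For $r,s\in[4]$, a path $P$ with end vertices $p,q$ and lists $L(x)\subseteq[4]$ on its vertices is an $(r,s)$-forbidding path from $p$ to $q$ if: (i) for all $x\in L(p)$, $y\in L(q)$, there is an $L$-coloring $\gamma$ of $P$ with $\gamma(p)=x,\gamma(q)=y$ iff $x\ne r$ or $y\ne s$ (such $(x,y)$ is called admissible); (ii) for any $L$-coloring $\gamma$ of $P$ and any admissible pair $(x,y)$ with $x=\gamma(p)$ or $y=\gamma(q)$, there is an $L$-recoloring sequence of $P$ from $\gamma$ to an $L$-coloring $\delta$ with $\delta(p)=x,\delta(q)=y$ in which every internal vertex is recolored at most once and $p,q$ are not recolored until the last step. (Such paths of length six exist whenever $r\in L(p)\ne[4]$ and $s\in L(q)\ne[4]$.) Construction from a graph $G$ (each edge given an arbitrary orientation $(u,v)$): each $u\in V(G)$ is a vertex of $G'$ with $L(u)=\{1,2,3\}$,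 $\alpha(u)=1$. For each edge $uv\in E(G)$ add vertices $x_{uv},y_{uv},z_{uv}$ with $L(x_{uv})=\{1,2,4\}$, $L(y_{uv})=\{3,4\}$, $L(z_{uv})=\{1,2,4\}$, all with $\alpha$-value $4$; add edges $ux_{uv}$, $uy_{uv}$; and add, each with new internal vertices, an $(r,s)$-forbidding path of length six (internal lists $\subseteq[4]$) for each of: $(1,2)$ from $u$ to $x_{uv}$; $(3,1)$ from $u$ to $x_{uv}$; $(2,3)$ from $u$ to $y_{uv}$; $(2,1)$ from $v$ to $x_{uv}$; $(3,2)$ from $v$ to $x_{uv}$; $(1,3)$ from $v$ to $y_{uv}$; $(4,1)$ from $x_{uv}$ to $z_{uv}$; $(4,2)$ from $y_{uv}$ to $z_{uv}$. Let $Z=\{z_{uv}\}$. Add vertices $a,b,c,d$ with $\alpha(a)=1,\alpha(b)=2,\alpha(c)=3,\alpha(d)=4$, $L(a)=\{1,2,3\}$, $L(b)=\{1,2\}$, $L(c)=\{3,4\}$, $L(d)=\{4\}$, all edges among them except $cd$, and edges from every vertex of $Z$ to $c$. No other edges. $\alpha$ is extended arbitrarily to the internal vertices of the forbidding paths so as to be an $L$-coloring of $G'$ (possible by property (i)). The target $\beta$ equals $\alpha$ except $\beta(a)=2$, $\beta(b)=1$. -}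

module Defs where

open import Data.Nat using (ℕ; zero; suc; _≤_; _*_; _∸_)
open import Data.Fin using (Fin; zero; suc; toℕ; fromℕ; inject₁)
open import Data.Fin.Subset using (Subset; _∈_; inside; outside)
open import Data.Vec using (_∷_; [])
open import Data.Product using (Σ; _×_; _,_; proj₁; proj₂; swap)
open import Data.Sum using (_⊎_)
open import Relation.Binary.PropositionalEquality using (_≡_; _≢_)

-- Colours: [4] = {1,2,3,4} is represented by Fin 4, with colour i being
-- the element of Fin 4 with toℕ = i - 1.

Col : Set
Col = Fin 4

c1 c2 c3 c4 : Col
c1 = zero
c2 = suc zero
c3 = suc (suc zero)
c4 = suc (suc (suc zero))

S123 S124 S12 S34 S4 : Subset 4
S123 = inside ∷ inside ∷ inside ∷ outside ∷ []
S124 = inside ∷ inside ∷ outside ∷ inside ∷ []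
S12  = inside ∷ inside ∷ outside ∷ outside ∷ []
S34  = outside ∷ outside ∷ inside ∷ inside ∷ []
S4   = outside ∷ outside ∷ outside ∷ inside ∷ []

module _ {V : Set} (Adj : V → V → Set) (L : V → Subset 4) where

  IsLColoring : (V → Col) → Set
  IsLColoring γ = (∀ x → γ x ∈ L x) × (∀ x y → Adj x y → γ x ≢ γ y)

  record RecoloringSeq (k : ℕ) : Set where
    field
      col    : Fin (suc k) → V → Col
      proper : ∀ i → IsLColoring (col i)
      -- consecutive colourings are equal or differ on exactly one vertex
      -- (i.e. they agree outside some single vertex v)
      step   : ∀ (i : Fin k) → Σ V λ v →
                 ∀ w → w ≢ v → col (inject₁ i) w ≡ col (suc i) w

  open RecoloringSeq public

  RecoloredAt : ∀ {k} → RecoloringSeq k → V → Fin k → Set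
  RecoloredAt S w i = col S (inject₁ i) w ≢ col S (suc i) w

PathAdj : Fin 7 → Fin 7 → Set
PathAdj i j = (toℕ j ≡ suc (toℕ i)) ⊎ (toℕ i ≡ suc (toℕ j))

pEnd qEnd : Fin 7
pEnd = zero
qEnd = fromℕ 6

module _ (LP : Fin 7 → Subset 4) where

  Admissible : Col → Col → Set
  Admissible x y = Σ (Fin 7 → Col) λ γ →
    IsLColoring PathAdj LP γ × γ pEnd ≡ x × γ qEnd ≡ y

  IsForbiddingPath : Col → Col → Set
  IsForbiddingPath r s =
    (∀ x y → x ∈ LP pEnd → y ∈ LP qEnd →
       (Admissible x y → (x ≢ r ⊎ y ≢ s)) × ((x ≢ r ⊎ y ≢ s) → Admissible x y))
    ×
    (∀ γ → IsLColoring PathAdj LP γ → ∀ x y → Admissible x y →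
       (x ≡ γ pEnd ⊎ y ≡ γ qEnd) →
       Σ ℕ λ k → Σ (RecoloringSeq PathAdj LP k) λ S →
         (∀ w → col S zero w ≡ γ w)
         × col S (fromℕ k) pEnd ≡ x
         × col S (fromℕ k) qEnd ≡ y
         × (∀ w → w ≢ pEnd → w ≢ qEnd → ∀ i i' →
              RecoloredAt PathAdj LP S w i → RecoloredAt PathAdj LP S w i' → i ≡ i')
         × (∀ i → (RecoloredAt PathAdj LP S pEnd i ⊎ RecoloredAt PathAdj LP S qEnd i) →
              suc (toℕ i) ≡ k))

-- The input graph G: n vertices Fin n, m edges given as an injective
-- family of oriented edges E : Fin m → Fin n × Fin n (orientation (u,v)).

IsSimpleEdgeFamily : ∀ {n m} → (Fin m → Fin n × Fin n) → Set
IsSimpleEdgeFamily {n} {m} E =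
  (∀ e → proj₁ (E e) ≢ proj₂ (E e))
  × (∀ e e' → e ≢ e' → E e ≢ E e' × E e ≢ swap (E e'))

ThreeColorable : ∀ {n m} → (Fin m → Fin n × Fin n) → Set
ThreeColorable {n} E = Σ (Fin n → Fin 3) λ f →
  ∀ e → f (proj₁ (E e)) ≢ f (proj₂ (E e))

data V' (n m : ℕ) : Set where
  orig       : Fin n → V' n m
  xv yv zv   : Fin m → V' n m
  -- internal vertex i (i = 0..4) of the forbidding path of type t for edge e
  int        : Fin m → Fin 8 → Fin 5 → V' n m
  va vb vc vd : V' n m

-- The eight forbidding paths per edge uv (u = proj₁, v = proj₂):
--  t=0: (1,2) u→x ; t=1: (3,1) u→x ; t=2: (2,3) u→y ; t=3: (2,1) v→x ;
--  t=4: (3,2) v→x ; t=5: (1,3) v→y ; t=6: (4,1) x→z ; t=7: (4,2) y→z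
module _ {n m : ℕ} (E : Fin m → Fin n × Fin n) where

  pathFrom pathTo : Fin m → Fin 8 → V' n m
  pathFrom e zero = orig (proj₁ (E e))
  pathFrom e (suc zero) = orig (proj₁ (E e))
  pathFrom e (suc (suc zero)) = orig (proj₁ (E e))
  pathFrom e (suc (suc (suc zero))) = orig (proj₂ (E e))
  pathFrom e (suc (suc (suc (suc zero)))) = orig (proj₂ (E e))
  pathFrom e (suc (suc (suc (suc (suc zero))))) = orig (proj₂ (E e))
  pathFrom e (suc (suc (suc (suc (suc (suc zero)))))) = xv e
  pathFrom e (suc (suc (suc (suc (suc (suc (suc zero))))))) = yv e

  pathTo e zero = xv e
  pathTo e (suc zero) = xv e
  pathTo e (suc (suc zero)) = yv e
  pathTo e (suc (suc (suc zero))) = xv e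
  pathTo e (suc (suc (suc (suc zero)))) = xv e
  pathTo e (suc (suc (suc (suc (suc zero))))) = yv e
  pathTo e (suc (suc (suc (suc (suc (suc zero)))))) = zv e
  pathTo e (suc (suc (suc (suc (suc (suc (suc zero))))))) = zv e

  pathVert : Fin m → Fin 8 → Fin 7 → V' n m
  pathVert e t zero = pathFrom e t
  pathVert e t (suc zero) = int e t zero
  pathVert e t (suc (suc zero)) = int e t (suc zero)
  pathVert e t (suc (suc (suc zero))) = int e t (suc (suc zero))
  pathVert e t (suc (suc (suc (suc zero)))) = int e t (suc (suc (suc zero)))
  pathVert e t (suc (suc (suc (suc (suc zero))))) = int e t (suc (suc (suc (suc zero))))
  pathVert e t (suc (suc (suc (suc (suc (suc zero)))))) = pathTo e t

  data Edge' : V' n m → V' n m → Set where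
    ux   : ∀ e → Edge' (orig (proj₁ (E e))) (xv e)
    uy   : ∀ e → Edge' (orig (proj₁ (E e))) (yv e)
    path : ∀ e t (i : Fin 6) → Edge' (pathVert e t (inject₁ i)) (pathVert e t (suc i))
    zc   : ∀ e → Edge' (zv e) vc
    ab   : Edge' va vb
    ac   : Edge' va vc
    ad   : Edge' va vd
    bc   : Edge' vb vc
    bd   : Edge' vb vd

  Adj' : V' n m → V' n m → Set
  Adj' x y = Edge' x y ⊎ Edge' y x

pathR pathS : Fin 8 → Col
pathR zero = c1
pathR (suc zero) = c3
pathR (suc (suc zero)) = c2
pathR (suc (suc (suc zero))) = c2
pathR (suc (suc (suc (suc zero)))) = c3
pathR (suc (suc (suc (suc (suc zero))))) = c1
pathR (suc (suc (suc (suc (suc (suc zero)))))) = c4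
pathR (suc (suc (suc (suc (suc (suc (suc zero))))))) = c4
pathS zero = c2
pathS (suc zero) = c1
pathS (suc (suc zero)) = c3
pathS (suc (suc (suc zero))) = c1
pathS (suc (suc (suc (suc zero)))) = c2
pathS (suc (suc (suc (suc (suc zero))))) = c3
pathS (suc (suc (suc (suc (suc (suc zero)))))) = c1
pathS (suc (suc (suc (suc (suc (suc (suc zero))))))) = c2

module _ {n m : ℕ} (IL : Fin m → Fin 8 → Fin 5 → Subset 4) where

  L' : V' n m → Subset 4
  L' (orig _) = S123
  L' (xv _) = S124
  L' (yv _) = S34
  L' (zv _) = S124
  L' (int e t i) = IL e t i
  L' va = S123
  L' vb = S12
  L' vc = S34
  L' vd = S4

module _ {n m : ℕ} (αI : Fin m → Fin 8 → Fin 5 → Col) where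

  α' β' : V' n m → Col
  α' (orig _) = c1
  α' (xv _) = c4
  α' (yv _) = c4
  α' (zv _) = c4
  α' (int e t i) = αI e t i
  α' va = c1
  α' vb = c2
  α' vc = c3
  α' vd = c4

  β' va = c2
  β' vb = c1
  β' x = α' x

-- By property (ii), the five inner vertices of a forbidding path can be recoloured, in at most
-- five steps and with both ends fixed, into colours compatible with the old end colours and with
-- any admissible new ones.  The paths of a gadget, and the gadgets of distinct edges, do not
-- interact, so such local walks can run one after another.  Starting from α: prepare the paths
-- at every u and v, recolour the vertices of G by a 3-colouring, then in each gadget move x or y,
-- and then z, away from colour 4.  No neighbour of c has colour 4 any more, so c goes to 4, a and
-- b swap via colour 3, and c returns to 3.  The same walk from β, reversed, completes a
-- recolouring of length 248m + 5.

module Submission where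

open import Defs
open import Data.Nat using (ℕ; zero; suc; _≤_; _*_; _+_; _<_; z≤n)
import Data.Nat.Properties as ℕ
open import Data.Nat.Tactic.RingSolver using (solve-∀)
open import Data.Fin using (Fin; zero; suc; fromℕ; toℕ; inject₁)
import Data.Fin.Properties as Fin
open import Data.Fin.Properties using (all?)
open import Data.Fin.Subset using (Subset; _∈_; ∣_∣; _∪_; ⁅_⁆) renaming (⊥ to ∅)
open import Data.Fin.Subset.Properties
  using (_∈?_; ∣p∣≤n; ∉⊥; p⊆p∪q; x∈p∪q⁺; x∈p∪q⁻; x∈⁅x⁆; x∈⁅y⁆⇒x≡y; p⊂q⇒∣p∣<∣q∣)
open import Data.Product using (Σ; _×_; _,_; proj₁; proj₂)
open import Data.Sum using (_⊎_; inj₁; inj₂)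
open import Function using (_∘_)
open import Data.Vec.Functional using (_∷_; []; tail; updateAt)
open import Data.Vec.Functional.Properties using (updateAt-updates; updateAt-minimal)
open import Data.Vec as Vec using (Vec; allFin)
open import Data.Vec.Membership.Propositional using () renaming (_∈_ to _∈ᵥ_)
open import Data.Vec.Membership.Propositional.Properties using (∈-allFin⁺)
open import Data.Vec.Relation.Unary.Any using (here; there)
open import Relation.Binary.PropositionalEquality
open import Relation.Nullary using (Dec; yes; no)
open import Relation.Nullary.Decidable using (¬?; _×-dec_; _⊎-dec_; _→-dec_; True; toWitness)
open import Data.Empty using (⊥-elim)

AgreeOff : {V : Set} → (V → Col) → (V → Col) → V → Set
AgreeOff Γ Δ v = ∀ w → w ≢ v → Γ w ≡ Δ w

-- Recolouring walks

-- Only the colourings after the first one are required to satisfy Ok.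
data Walk {V : Set} (Ok : (V → Col) → Set) : (V → Col) → (V → Col) → ℕ → Set where
  done : ∀ {Γ Δ} → Γ ≗ Δ → Walk Ok Γ Δ 0
  recolour : ∀ {Γ Δ k} Γ' v → AgreeOff Γ Γ' v → Ok Γ' → Walk Ok Γ' Δ k → Walk Ok Γ Δ (suc k)

Reach : {V : Set} → ((V → Col) → Set) → ℕ → (V → Col) → (V → Col) → Set
Reach Ok B Γ Δ = Σ ℕ λ k → k ≤ B × Walk Ok Γ Δ k

module _ {V : Set} {Ok : (V → Col) → Set} where

  Walk-cast : ∀ {Γ₀ Γ Δ Δ₀ k} → Γ₀ ≗ Γ → Δ ≗ Δ₀ → Walk Ok Γ Δ k → Walk Ok Γ₀ Δ₀ k
  Walk-cast e₀ e₁ (done p) = done (λ w → trans (e₀ w) (trans (p w) (e₁ w)))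
  Walk-cast e₀ e₁ (recolour Γ' v a o W) =
    recolour Γ' v (λ w ne → trans (e₀ w) (a w ne)) o (Walk-cast (λ _ → refl) e₁ W)

  _++_ : ∀ {Γ Δ Θ k j} → Walk Ok Γ Δ k → Walk Ok Δ Θ j → Walk Ok Γ Θ (k + j)
  done p ++ W = Walk-cast p (λ _ → refl) W
  recolour Γ' v a o W ++ W' = recolour Γ' v a o (W ++ W')

  private
    reverseOnto : ∀ {Γ Δ Θ k j} → Ok Γ → Walk Ok Γ Δ k → Walk Ok Γ Θ j → Walk Ok Δ Θ (k + j)
    reverseOnto o (done p) A = Walk-cast (sym ∘ p) (λ _ → refl) A
    reverseOnto {k = suc k} {j} o (recolour Γ' v a o' W) A =
      subst (Walk Ok _ _) (ℕ.+-suc k j) (reverseOnto o' W (recolour _ v (λ w ne → sym (a w ne)) o A))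

  reverse : ∀ {Γ Δ k} → Ok Γ → Walk Ok Γ Δ k → Walk Ok Δ Γ k
  reverse {k = k} o W = subst (Walk Ok _ _) (ℕ.+-identityʳ k) (reverseOnto o W (done (λ _ → refl)))

  Reach-cast : ∀ {Γ₀ Γ Δ Δ₀ B} → Γ₀ ≗ Γ → Δ ≗ Δ₀ → Reach Ok B Γ Δ → Reach Ok B Γ₀ Δ₀
  Reach-cast e₀ e₁ (k , k≤B , W) = k , k≤B , Walk-cast e₀ e₁ W

  infixr 5 _⟫_
  _⟫_ : ∀ {Γ Δ Θ B B'} → Reach Ok B Γ Δ → Reach Ok B' Δ Θ → Reach Ok (B + B') Γ Θ
  (k , k≤B , W) ⟫ (k' , k'≤B' , W') = k + k' , ℕ.+-mono-≤ k≤B k'≤B' , W ++ W'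

  Reach-reverse : ∀ {Γ Δ B} → Ok Γ → Reach Ok B Γ Δ → Reach Ok B Δ Γ
  Reach-reverse o (k , k≤B , W) = k , k≤B , reverse o W

  Reach-refl : ∀ {Γ B} → Reach Ok B Γ Γ
  Reach-refl = 0 , z≤n , done (λ _ → refl)

  Reach-single : ∀ {Γ Γ'} v → AgreeOff Γ Γ' v → Ok Γ' → Reach Ok 1 Γ Γ'
  Reach-single v a o = 1 , ℕ.≤-refl , recolour _ v a o (done (λ _ → refl))

module _ {V W : Set} {OkV : (V → Col) → Set} {OkW : (W → Col) → Set}
  (f : (V → Col) → (W → Col)) (vertex : V → W)
  (f-cong : ∀ {Γ Δ} → Γ ≗ Δ → f Γ ≗ f Δ)
  (f-agreeOff : ∀ {Γ Δ v} → AgreeOff Γ Δ v → AgreeOff (f Γ) (f Δ) (vertex v))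
  (f-ok : ∀ {Γ} → OkV Γ → OkW (f Γ)) where

  Walk-map : ∀ {Γ Δ k} → Walk OkV Γ Δ k → Walk OkW (f Γ) (f Δ) k
  Walk-map (done p) = done (f-cong p)
  Walk-map (recolour Γ' v a o W) = recolour (f Γ') (vertex v) (f-agreeOff a) (f-ok o) (Walk-map W)

  Reach-map : ∀ {Γ Δ B} → Reach OkV B Γ Δ → Reach OkW B (f Γ) (f Δ)
  Reach-map (k , k≤B , W) = k , k≤B , Walk-map W

module _ {V : Set} {Adj : V → V → Set} {L : V → Subset 4} where

  IsLColoring-resp : ∀ {γ δ} → γ ≗ δ → IsLColoring Adj L γ → IsLColoring Adj L δ
  IsLColoring-resp γ≗δ (lists , proper) =
    (λ x → subst (_∈ L x) (γ≗δ x) (lists x)) ,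
    (λ x y adj eq → proper x y adj (trans (γ≗δ x) (trans eq (sym (γ≗δ y)))))

  toRecoloringSeq : ∀ {Γ Δ k} → IsLColoring Adj L Γ → Walk (IsLColoring Adj L) Γ Δ k →
    Σ (RecoloringSeq Adj L k) λ S → (∀ w → col S zero w ≡ Γ w) × (∀ w → col S (fromℕ k) w ≡ Δ w)
  toRecoloringSeq {Γ} o (done p) =
    record { col = λ _ → Γ ; proper = λ _ → o ; step = λ () } , (λ _ → refl) , p
  toRecoloringSeq {Γ} {k = suc k} o (recolour Γ' v a o' W) with toRecoloringSeq o' W
  ... | S , S₀ , Sₖ = record { col = cols ; proper = propers ; step = steps } , (λ _ → refl) , Sₖ
    where
    cols : Fin (suc (suc k)) → V → Col
    cols zero = Γ
    cols (suc i) = col S i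
    propers : ∀ i → IsLColoring Adj L (cols i)
    propers zero = o
    propers (suc i) = proper S i
    steps : ∀ i → Σ V λ v' → ∀ w → w ≢ v' → cols (inject₁ i) w ≡ cols (suc i) w
    steps zero = v , λ w ne → trans (a w ne) (sym (S₀ w))
    steps (suc i) = step S i

RecolouredAtMostOnce : ∀ {N k} → (Fin (suc k) → Fin N → Col) → Set
RecolouredAtMostOnce c =
  ∀ w i i' → c (inject₁ i) w ≢ c (suc i) w → c (inject₁ i') w ≢ c (suc i') w → i ≡ i'

SingleSteps : ∀ {N k} → (Fin (suc k) → Fin N → Col) → Set
SingleSteps {N} c = ∀ i → Σ (Fin N) (AgreeOff (c (inject₁ i)) (c (suc i)))

module _ {N : ℕ} {Ok : (Fin N → Col) → Set} where

  -- Dropping the trivial steps leaves one step per recoloured vertex; U collects the vertices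
  -- recoloured so far, which never change again.
  private
    shortenOutside : ∀ k (c : Fin (suc k) → Fin N → Col) → SingleSteps c → (∀ i → Ok (c i)) →
      RecolouredAtMostOnce c → (U : Subset N) → (∀ w → w ∈ U → ∀ i → c (inject₁ i) w ≡ c (suc i) w) →
      Σ ℕ λ j → j + ∣ U ∣ ≤ N × Walk Ok (c zero) (c (fromℕ k)) j
    shortenOutside zero c steps ok once U fixed = 0 , ∣p∣≤n U , done (λ _ → refl)
    shortenOutside (suc k) c steps ok once U fixed with steps zero
    ... | v , agree with c zero v Fin.≟ c (suc zero) v
    ... | yes same
      with shortenOutside k (c ∘ suc) (steps ∘ suc) (ok ∘ suc)
             (λ w i i' d d' → Fin.suc-injective (once w (suc i) (suc i') d d')) U (λ w w∈U i → fixed w w∈U (suc i))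
    ... | j , bound , W = j , bound , Walk-cast unchanged (λ _ → refl) W
      where
      unchanged : c zero ≗ c (suc zero)
      unchanged w with w Fin.≟ v
      ... | yes refl = same
      ... | no w≢v = agree w w≢v
    shortenOutside (suc k) c steps ok once U fixed | v , agree | no changed
      with shortenOutside k (c ∘ suc) (steps ∘ suc) (ok ∘ suc)
             (λ w i i' d d' → Fin.suc-injective (once w (suc i) (suc i') d d')) (U ∪ ⁅ v ⁆) fixed'
      where
      fixed' : ∀ w → w ∈ U ∪ ⁅ v ⁆ → ∀ i → c (suc (inject₁ i)) w ≡ c (suc (suc i)) w
      fixed' w w∈ i with x∈p∪q⁻ U ⁅ v ⁆ w∈
      ... | inj₁ w∈U = fixed w w∈U (suc i)
      ... | inj₂ w∈v with x∈⁅y⁆⇒x≡y v w∈v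
      ... | refl with c (suc (inject₁ i)) w Fin.≟ c (suc (suc i)) w
      ... | yes same = same
      ... | no changed' = ⊥-elim (Fin.0≢1+n (once w zero (suc i) changed changed'))
    ... | j , bound , W = suc j , bound' , recolour (c (suc zero)) v agree (ok (suc zero)) W
      where
      ∣U∣<∣U∪v∣ : ∣ U ∣ < ∣ U ∪ ⁅ v ⁆ ∣
      ∣U∣<∣U∪v∣ = p⊂q⇒∣p∣<∣q∣
        (p⊆p∪q ⁅ v ⁆ , v , x∈p∪q⁺ (inj₂ (x∈⁅x⁆ v)) , λ v∈U → changed (fixed v v∈U zero))
      bound' : suc j + ∣ U ∣ ≤ N
      bound' = ℕ.≤-trans (ℕ.≤-reflexive (sym (ℕ.+-suc j ∣ U ∣)))
                         (ℕ.≤-trans (ℕ.+-monoʳ-≤ j ∣U∣<∣U∪v∣) bound)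

  shorten : ∀ {k} (c : Fin (suc k) → Fin N → Col) → SingleSteps c → (∀ i → Ok (c i)) →
    RecolouredAtMostOnce c → Reach Ok N (c zero) (c (fromℕ k))
  shorten {k} c steps ok once with shortenOutside k c steps ok once ∅ (λ w w∈∅ → ⊥-elim (∉⊥ w∈∅))
  ... | j , bound , W = j , ℕ.≤-trans (ℕ.m≤m+n j _) bound , W

-- Independent components are recoloured one after another.
componentwise : ∀ N {W V : Set} {Ok : (V → Col) → Set} {Good : Fin N → (W → Col) → Set} {B}
  (build : (Fin N → W → Col) → V → Col) (at : Fin N → W → V) →
  (∀ {F F'} → (∀ i → F i ≗ F' i) → build F ≗ build F') →
  (∀ {F F' i w} → (∀ j w' → at j w' ≢ at i w → F j w' ≡ F' j w') → AgreeOff (build F) (build F') (at i w)) →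
  (∀ {F} → (∀ i → Good i (F i)) → Ok (build F)) →
  ∀ {F F'} → (∀ i → Good i (F i)) → (∀ i → Good i (F' i)) → (∀ i → Reach (Good i) B (F i) (F' i)) →
  Reach Ok (N * B) (build F) (build F')
componentwise zero build at build-cong _ _ _ _ _ = Reach-cast (λ _ → refl) (build-cong (λ ())) Reach-refl
componentwise (suc N) {Good = Good} build at build-cong build-agreeOff build-ok {F} {F'} good good' walks =
  Reach-cast (build-cong λ { zero _ → refl ; (suc i) _ → refl }) (λ _ → refl)
    (Reach-map (λ δ → build (δ ∷ tail F)) (at zero)
       (λ δ≗δ' → build-cong λ { zero → δ≗δ' ; (suc i) _ → refl })
       (λ agree → build-agreeOff λ { zero w' ne → agree w' (ne ∘ cong (at zero)) ; (suc j) w' _ → refl })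
       (λ ok → build-ok λ { zero → ok ; (suc i) → good (suc i) })
       (walks zero))
  ⟫ Reach-cast (λ _ → refl) (build-cong λ { zero _ → refl ; (suc i) _ → refl })
      (componentwise N (λ G → build (F' zero ∷ G)) (at ∘ suc)
         (λ G≗G' → build-cong λ { zero _ → refl ; (suc i) → G≗G' i })
         (λ same → build-agreeOff λ { zero _ _ → refl ; (suc j) w' ne → same j w' ne })
         (λ ok → build-ok λ { zero → good' zero ; (suc i) → ok i })
         (good ∘ suc) (good' ∘ suc) (walks ∘ suc))

changedVertex : ∀ {N} {ρ δ : Fin N → Col} {v w} → AgreeOff ρ δ v → ρ w ≢ δ w → v ≡ w
changedVertex {v = v} {w} agree ρw≢δw with v Fin.≟ w
... | yes v≡w = v≡w
... | no v≢w = ⊥-elim (ρw≢δw (agree w (v≢w ∘ sym)))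

-- Forbidding paths

glue : Col → (Fin 5 → Col) → Col → Fin 7 → Col
glue a ι b zero = a
glue a ι b (suc zero) = ι zero
glue a ι b (suc (suc zero)) = ι (suc zero)
glue a ι b (suc (suc (suc zero))) = ι (suc (suc zero))
glue a ι b (suc (suc (suc (suc zero)))) = ι (suc (suc (suc zero)))
glue a ι b (suc (suc (suc (suc (suc zero))))) = ι (suc (suc (suc (suc zero))))
glue a ι b (suc (suc (suc (suc (suc (suc zero)))))) = b

inner : Fin 5 → Fin 7
inner j = suc (inject₁ j)

innerIndex : Fin 7 → Fin 5
innerIndex (suc (suc zero)) = suc zero
innerIndex (suc (suc (suc zero))) = suc (suc zero)
innerIndex (suc (suc (suc (suc zero)))) = suc (suc (suc zero))
innerIndex (suc (suc (suc (suc (suc zero))))) = suc (suc (suc (suc zero)))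
innerIndex _ = zero

innerIndex-inner : ∀ j → innerIndex (inner j) ≡ j
innerIndex-inner zero = refl
innerIndex-inner (suc zero) = refl
innerIndex-inner (suc (suc zero)) = refl
innerIndex-inner (suc (suc (suc zero))) = refl
innerIndex-inner (suc (suc (suc (suc zero)))) = refl

inner≢pEnd : ∀ j → inner j ≢ pEnd
inner≢pEnd j ()

inner≢qEnd : ∀ j → inner j ≢ qEnd
inner≢qEnd zero ()
inner≢qEnd (suc zero) ()
inner≢qEnd (suc (suc zero)) ()
inner≢qEnd (suc (suc (suc zero))) ()
inner≢qEnd (suc (suc (suc (suc zero)))) ()

interior : (Fin 7 → Col) → Fin 5 → Col
interior γ = γ ∘ inner

interior-glue : ∀ a ι b → interior (glue a ι b) ≗ ι
interior-glue a ι b zero = refl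
interior-glue a ι b (suc zero) = refl
interior-glue a ι b (suc (suc zero)) = refl
interior-glue a ι b (suc (suc (suc zero))) = refl
interior-glue a ι b (suc (suc (suc (suc zero)))) = refl

glue-interior : ∀ {γ ι a b} → ι ≗ interior γ → γ pEnd ≡ a → γ qEnd ≡ b → γ ≗ glue a ι b
glue-interior ι≗ γa γb zero = γa
glue-interior ι≗ γa γb (suc zero) = sym (ι≗ zero)
glue-interior ι≗ γa γb (suc (suc zero)) = sym (ι≗ (suc zero))
glue-interior ι≗ γa γb (suc (suc (suc zero))) = sym (ι≗ (suc (suc zero)))
glue-interior ι≗ γa γb (suc (suc (suc (suc zero)))) = sym (ι≗ (suc (suc (suc zero))))
glue-interior ι≗ γa γb (suc (suc (suc (suc (suc zero))))) = sym (ι≗ (suc (suc (suc (suc zero)))))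
glue-interior ι≗ γa γb (suc (suc (suc (suc (suc (suc zero)))))) = γb

PathOk : (Fin 7 → Subset 4) → Col → Col → (Fin 5 → Col) → Set
PathOk LP a b ι = IsLColoring PathAdj LP (glue a ι b)

Retargetable : (Fin 7 → Subset 4) → (r s a b a' b' : Col) → Set
Retargetable LP r s a b a' b' =
  a' ∈ LP pEnd × b' ∈ LP qEnd × (a' ≢ r ⊎ b' ≢ s) × (a' ≡ a ⊎ b' ≡ b)

record Retargeting (LP : Fin 7 → Subset 4) (a b a' b' : Col) (ι : Fin 5 → Col) : Set where
  field
    interior′ : Fin 5 → Col
    ok-new : PathOk LP a' b' interior′
    ok-old : PathOk LP a b interior′
    walk : Reach (PathOk LP a b) 5 ι interior′

constantBeforeLast : ∀ {A : Set} {k} (f : Fin (suc k) → A) →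
  (∀ (i : Fin k) → suc (toℕ i) ≢ k → f (inject₁ i) ≡ f (suc i)) →
  ∀ (i : Fin k) → f (inject₁ i) ≡ f zero
constantBeforeLast f constant zero = refl
constantBeforeLast {k = suc (suc k)} f constant (suc i) =
  trans (constantBeforeLast (f ∘ suc) (λ j ne → constant (suc j) (ne ∘ ℕ.suc-injective)) i)
        (sym (constant zero (ℕ.0≢1+n ∘ ℕ.suc-injective)))

module _ {LP : Fin 7 → Subset 4} where

  PathOk-interior : ∀ {γ a b} → IsLColoring PathAdj LP γ → γ pEnd ≡ a → γ qEnd ≡ b →
    PathOk LP a b (interior γ)
  PathOk-interior γok γa γb = IsLColoring-resp (glue-interior (λ _ → refl) γa γb) γok

  PathOk-innerUnchanged : ∀ {ρ δ v a b} → AgreeOff ρ δ v → (∀ j → inner j ≢ v) →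
    IsLColoring PathAdj LP ρ → ρ pEnd ≡ a → ρ qEnd ≡ b → PathOk LP a b (interior δ)
  PathOk-innerUnchanged agree inner≢v ρok ρa ρb =
    IsLColoring-resp (glue-interior (λ j → sym (agree (inner j) (inner≢v j))) ρa ρb) ρok

  -- A single recolouring either keeps both end colours or does not touch the interior.
  PathOk-afterStep : ∀ {ρ δ v a b} → AgreeOff ρ δ v → IsLColoring PathAdj LP ρ → ρ pEnd ≡ a → ρ qEnd ≡ b →
    IsLColoring PathAdj LP δ → PathOk LP a b (interior δ)
  PathOk-afterStep {ρ} {δ} {v} {a} {b} agree ρok ρa ρb δok with δ pEnd Fin.≟ a | δ qEnd Fin.≟ b
  ... | yes δa | yes δb = PathOk-interior δok δa δb
  ... | no δ≢a | _ with changedVertex agree (λ eq → δ≢a (trans (sym eq) ρa))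
  ...   | refl = PathOk-innerUnchanged agree inner≢pEnd ρok ρa ρb
  PathOk-afterStep {ρ} {δ} {v} {a} {b} agree ρok ρa ρb δok | yes _ | no δ≢b
    with changedVertex agree (λ eq → δ≢b (trans (sym eq) ρb))
  ...   | refl = PathOk-innerUnchanged agree inner≢qEnd ρok ρa ρb

  -- Property (ii) restricted to the inner vertices: the ends only move in the last step, and
  -- at most one step per inner vertex survives once the trivial ones are dropped.
  retarget : ∀ {r s a b a' b' ι} → IsForbiddingPath LP r s → PathOk LP a b ι → Retargetable LP r s a b a' b' →
    Retargeting LP a b a' b' ι
  retarget {a = a} {b} {a'} {b'} {ι} (admissible , recolourable) ιok (a'∈ , b'∈ , allowed , oneFixed)
    with recolourable (glue a ι b) ιok a' b' (proj₂ (admissible a' b' a'∈ b'∈) allowed) oneFixed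
  ... | k , S , S₀ , Sₖa' , Sₖb' , once , endsLast = record
    { interior′ = interior (col S (fromℕ k))
    ; ok-new = PathOk-interior (proper S (fromℕ k)) Sₖa' Sₖb'
    ; ok-old = interiorOk (fromℕ k)
    ; walk = Reach-cast (λ j → sym (trans (S₀ (inner j)) (interior-glue a ι b j))) (λ _ → refl)
               (shorten (interior ∘ col S) steps interiorOk
                  (λ w i i' → once (inner w) (inner≢pEnd w) (inner≢qEnd w) i i'))
    }
    where
    endUnchanged : ∀ e → (∀ i → RecoloredAt PathAdj LP S e i → suc (toℕ i) ≡ k) →
      ∀ (i : Fin k) → suc (toℕ i) ≢ k → col S (inject₁ i) e ≡ col S (suc i) e
    endUnchanged e last i notLast with col S (inject₁ i) e Fin.≟ col S (suc i) e
    ... | yes same = same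
    ... | no changed = ⊥-elim (notLast (last i changed))
    endsBefore : ∀ (i : Fin k) → col S (inject₁ i) pEnd ≡ a × col S (inject₁ i) qEnd ≡ b
    endsBefore i =
      trans (constantBeforeLast (λ j → col S j pEnd) (endUnchanged pEnd (λ j → endsLast j ∘ inj₁)) i)
            (S₀ pEnd) ,
      trans (constantBeforeLast (λ j → col S j qEnd) (endUnchanged qEnd (λ j → endsLast j ∘ inj₂)) i)
            (S₀ qEnd)
    interiorOk : ∀ i → PathOk LP a b (interior (col S i))
    interiorOk zero = PathOk-interior (proper S zero) (S₀ pEnd) (S₀ qEnd)
    interiorOk (suc i) =
      PathOk-afterStep (proj₂ (step S i)) (proper S (inject₁ i)) (proj₁ (endsBefore i)) (proj₂ (endsBefore i))
        (proper S (suc i))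
    steps : SingleSteps (interior ∘ col S)
    steps i with step S i
    ... | v , agree =
      innerIndex v , λ j j≢ → agree (inner j) (λ eq → j≢ (trans (sym (innerIndex-inner j)) (cong innerIndex eq)))

-- Gadgets and colourings of G'

data GadgetVertex : Set where
  gx gy gz : GadgetVertex
  gint : Fin 8 → Fin 5 → GadgetVertex

gadget : Col → Col → Col → (Fin 8 → Fin 5 → Col) → GadgetVertex → Col
gadget x y z ι gx = x
gadget x y z ι gy = y
gadget x y z ι gz = z
gadget x y z ι (gint t j) = ι t j

interiors : (GadgetVertex → Col) → Fin 8 → Fin 5 → Col
interiors G t j = G (gint t j)

-- The end colours of path t of an edge uv (cf. pathFrom and pathTo).
startColour : (cu cv x y : Col) → Fin 8 → Col
startColour cu cv x y zero = cu
startColour cu cv x y (suc zero) = cu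
startColour cu cv x y (suc (suc zero)) = cu
startColour cu cv x y (suc (suc (suc zero))) = cv
startColour cu cv x y (suc (suc (suc (suc zero)))) = cv
startColour cu cv x y (suc (suc (suc (suc (suc zero))))) = cv
startColour cu cv x y (suc (suc (suc (suc (suc (suc zero)))))) = x
startColour cu cv x y (suc (suc (suc (suc (suc (suc (suc zero))))))) = y

finishColour : (x y z : Col) → Fin 8 → Col
finishColour x y z zero = x
finishColour x y z (suc zero) = x
finishColour x y z (suc (suc zero)) = y
finishColour x y z (suc (suc (suc zero))) = x
finishColour x y z (suc (suc (suc (suc zero)))) = x
finishColour x y z (suc (suc (suc (suc (suc zero))))) = y
finishColour x y z (suc (suc (suc (suc (suc (suc zero)))))) = z
finishColour x y z (suc (suc (suc (suc (suc (suc (suc zero))))))) = z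

FrameOk : (cu cc x y z : Col) → Set
FrameOk cu cc x y z = x ∈ S124 × y ∈ S34 × z ∈ S124 × cu ≢ x × cu ≢ y × z ≢ cc

KOk : (Fin 4 → Col) → Set
KOk k = k zero ∈ S123 × k (suc zero) ∈ S12 × k (suc (suc zero)) ∈ S34 × k (suc (suc (suc zero))) ∈ S4
  × k zero ≢ k (suc zero) × k zero ≢ k (suc (suc zero)) × k zero ≢ k (suc (suc (suc zero)))
  × k (suc zero) ≢ k (suc (suc zero)) × k (suc zero) ≢ k (suc (suc (suc zero)))

retargetable? : ∀ LP r s a b a' b' → Dec (Retargetable LP r s a b a' b')
retargetable? LP r s a b a' b' =
  a' ∈? LP pEnd ×-dec b' ∈? LP qEnd ×-dec (¬? (a' Fin.≟ r) ⊎-dec ¬? (b' Fin.≟ s))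
    ×-dec (a' Fin.≟ a ⊎-dec b' Fin.≟ b)

frameOk? : ∀ cu cc x y z → Dec (FrameOk cu cc x y z)
frameOk? cu cc x y z =
  x ∈? S124 ×-dec y ∈? S34 ×-dec z ∈? S124
    ×-dec ¬? (cu Fin.≟ x) ×-dec ¬? (cu Fin.≟ y) ×-dec ¬? (z Fin.≟ cc)

kOk? : ∀ k → Dec (KOk k)
kOk? k =
  k zero ∈? S123 ×-dec k (suc zero) ∈? S12 ×-dec k (suc (suc zero)) ∈? S34 ×-dec k (suc (suc (suc zero))) ∈? S4
  ×-dec ¬? (k zero Fin.≟ k (suc zero)) ×-dec ¬? (k zero Fin.≟ k (suc (suc zero)))
  ×-dec ¬? (k zero Fin.≟ k (suc (suc (suc zero)))) ×-dec ¬? (k (suc zero) Fin.≟ k (suc (suc zero)))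
  ×-dec ¬? (k (suc zero) Fin.≟ k (suc (suc (suc zero))))

record State (n m : ℕ) : Set where
  constructor state
  field
    origColour : Fin n → Col
    gadgetColour : Fin m → GadgetVertex → Col
    kColour : Fin 4 → Col
open State

colouring : ∀ {n m} → State n m → V' n m → Col
colouring S (orig w) = origColour S w
colouring S (xv e) = gadgetColour S e gx
colouring S (yv e) = gadgetColour S e gy
colouring S (zv e) = gadgetColour S e gz
colouring S (int e t j) = gadgetColour S e (gint t j)
colouring S va = kColour S zero
colouring S vb = kColour S (suc zero)
colouring S vc = kColour S (suc (suc zero))
colouring S vd = kColour S (suc (suc (suc zero)))

gadgetVertex : ∀ {n m} → Fin m → GadgetVertex → V' n m
gadgetVertex e gx = xv e
gadgetVertex e gy = yv e
gadgetVertex e gz = zv e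
gadgetVertex e (gint t j) = int e t j

kVertex : ∀ {n m} → Fin 4 → V' n m
kVertex zero = va
kVertex (suc zero) = vb
kVertex (suc (suc zero)) = vc
kVertex (suc (suc (suc zero))) = vd

module _ {n m} {o o' : Fin n → Col} {F F' : Fin m → GadgetVertex → Col} {k k' : Fin 4 → Col} where

  colouring-cong : o ≗ o' → (∀ e → F e ≗ F' e) → k ≗ k' →
    colouring (state o F k) ≗ colouring (state o' F' k')
  colouring-cong o≗ F≗ k≗ (orig w) = o≗ w
  colouring-cong o≗ F≗ k≗ (xv e) = F≗ e gx
  colouring-cong o≗ F≗ k≗ (yv e) = F≗ e gy
  colouring-cong o≗ F≗ k≗ (zv e) = F≗ e gz
  colouring-cong o≗ F≗ k≗ (int e t j) = F≗ e (gint t j)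
  colouring-cong o≗ F≗ k≗ va = k≗ zero
  colouring-cong o≗ F≗ k≗ vb = k≗ (suc zero)
  colouring-cong o≗ F≗ k≗ vc = k≗ (suc (suc zero))
  colouring-cong o≗ F≗ k≗ vd = k≗ (suc (suc (suc zero)))

  colouring-agreeOff : ∀ {v} → (∀ w → orig w ≢ v → o w ≡ o' w) →
    (∀ e g → gadgetVertex e g ≢ v → F e g ≡ F' e g) → (∀ i → kVertex i ≢ v → k i ≡ k' i) →
    AgreeOff (colouring (state o F k)) (colouring (state o' F' k')) v
  colouring-agreeOff same-o same-F same-k (orig w) ne = same-o w ne
  colouring-agreeOff same-o same-F same-k (xv e) ne = same-F e gx ne
  colouring-agreeOff same-o same-F same-k (yv e) ne = same-F e gy ne
  colouring-agreeOff same-o same-F same-k (zv e) ne = same-F e gz ne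
  colouring-agreeOff same-o same-F same-k (int e t j) ne = same-F e (gint t j) ne
  colouring-agreeOff same-o same-F same-k va ne = same-k zero ne
  colouring-agreeOff same-o same-F same-k vb ne = same-k (suc zero) ne
  colouring-agreeOff same-o same-F same-k vc ne = same-k (suc (suc zero)) ne
  colouring-agreeOff same-o same-F same-k vd ne = same-k (suc (suc (suc zero))) ne

gadget-cong : ∀ {x y z ι ι'} → (∀ t → ι t ≗ ι' t) → gadget x y z ι ≗ gadget x y z ι'
gadget-cong ι≗ gx = refl
gadget-cong ι≗ gy = refl
gadget-cong ι≗ gz = refl
gadget-cong ι≗ (gint t j) = ι≗ t j

gadget-agreeOff : ∀ {x y z ι ι' v} → (∀ t j → gint t j ≢ v → ι t j ≡ ι' t j) →
  AgreeOff (gadget x y z ι) (gadget x y z ι') v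
gadget-agreeOff same gx ne = refl
gadget-agreeOff same gy ne = refl
gadget-agreeOff same gz ne = refl
gadget-agreeOff same (gint t j) ne = same t j ne

module Construction {n m : ℕ} (E : Fin m → Fin n × Fin n) (IL : Fin m → Fin 8 → Fin 5 → Subset 4) where

  src dst : Fin m → Fin n
  src e = proj₁ (E e)
  dst e = proj₂ (E e)

  pathLists : Fin m → Fin 8 → Fin 7 → Subset 4
  pathLists e t j = L' IL (pathVert E e t j)

  PathsOk : Fin m → (cu cv x y z : Col) → (Fin 8 → Fin 5 → Col) → Set
  PathsOk e cu cv x y z ι = ∀ t → PathOk (pathLists e t) (startColour cu cv x y t) (finishColour x y z t) (ι t)

  GadgetOk : Fin m → (cu cv cc : Col) → (GadgetVertex → Col) → Set
  GadgetOk e cu cv cc G = FrameOk cu cc (G gx) (G gy) (G gz) × PathsOk e cu cv (G gx) (G gy) (G gz) (interiors G)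

  record StateOk (S : State n m) : Set where
    field
      k-ok : KOk (kColour S)
      orig-ok : ∀ w → origColour S w ∈ S123
      gadget-ok : ∀ e → GadgetOk e (origColour S (src e)) (origColour S (dst e)) (kColour S (suc (suc zero)))
                                    (gadgetColour S e)

  Proper : (V' n m → Col) → Set
  Proper = IsLColoring (Adj' E) (L' IL)

  module _ (S : State n m) (e : Fin m) where
    private
      G = gadgetColour S e
      cu = origColour S (src e)
      cv = origColour S (dst e)

    colouring-pathFrom : ∀ t → colouring S (pathFrom E e t) ≡ startColour cu cv (G gx) (G gy) t
    colouring-pathFrom zero = refl
    colouring-pathFrom (suc zero) = refl
    colouring-pathFrom (suc (suc zero)) = refl
    colouring-pathFrom (suc (suc (suc zero))) = refl
    colouring-pathFrom (suc (suc (suc (suc zero)))) = refl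
    colouring-pathFrom (suc (suc (suc (suc (suc zero))))) = refl
    colouring-pathFrom (suc (suc (suc (suc (suc (suc zero)))))) = refl
    colouring-pathFrom (suc (suc (suc (suc (suc (suc (suc zero))))))) = refl

    colouring-pathTo : ∀ t → colouring S (pathTo E e t) ≡ finishColour (G gx) (G gy) (G gz) t
    colouring-pathTo zero = refl
    colouring-pathTo (suc zero) = refl
    colouring-pathTo (suc (suc zero)) = refl
    colouring-pathTo (suc (suc (suc zero))) = refl
    colouring-pathTo (suc (suc (suc (suc zero)))) = refl
    colouring-pathTo (suc (suc (suc (suc (suc zero))))) = refl
    colouring-pathTo (suc (suc (suc (suc (suc (suc zero)))))) = refl
    colouring-pathTo (suc (suc (suc (suc (suc (suc (suc zero))))))) = refl

    colouring-pathVert : ∀ t → colouring S ∘ pathVert E e t ≗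
      glue (startColour cu cv (G gx) (G gy) t) (interiors G t) (finishColour (G gx) (G gy) (G gz) t)
    colouring-pathVert t zero = colouring-pathFrom t
    colouring-pathVert t (suc zero) = refl
    colouring-pathVert t (suc (suc zero)) = refl
    colouring-pathVert t (suc (suc (suc zero))) = refl
    colouring-pathVert t (suc (suc (suc (suc zero)))) = refl
    colouring-pathVert t (suc (suc (suc (suc (suc zero))))) = refl
    colouring-pathVert t (suc (suc (suc (suc (suc (suc zero)))))) = colouring-pathTo t

  pathVert-inner : ∀ e t j → pathVert E e t (inner j) ≡ int e t j
  pathVert-inner e t zero = refl
  pathVert-inner e t (suc zero) = refl
  pathVert-inner e t (suc (suc zero)) = refl
  pathVert-inner e t (suc (suc (suc zero))) = refl
  pathVert-inner e t (suc (suc (suc (suc zero)))) = refl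

  pathVert-edge : ∀ e t (i j : Fin 7) → toℕ j ≡ suc (toℕ i) → Edge' E (pathVert E e t i) (pathVert E e t j)
  pathVert-edge e t i (suc j) j≡1+i with Fin.toℕ-injective {i = i} {j = inject₁ j}
                                           (trans (ℕ.suc-injective (sym j≡1+i)) (sym (Fin.toℕ-inject₁ j)))
  ... | refl = path e t j

  restrictToPath : ∀ {Γ} → Proper Γ → ∀ e t → IsLColoring PathAdj (pathLists e t) (Γ ∘ pathVert E e t)
  restrictToPath (lists , distinct) e t =
    (λ j → lists (pathVert E e t j)) ,
    λ { i j (inj₁ j≡1+i) → distinct _ _ (inj₁ (pathVert-edge e t i j j≡1+i))
      ; i j (inj₂ i≡1+j) → distinct _ _ (inj₂ (pathVert-edge e t j i i≡1+j)) }

  gadgetOk-paths : ∀ {S} → Proper (colouring S) → ∀ e →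
    PathsOk e (origColour S (src e)) (origColour S (dst e)) (gadgetColour S e gx) (gadgetColour S e gy)
      (gadgetColour S e gz) (interiors (gadgetColour S e))
  gadgetOk-paths {S} Sok e t = IsLColoring-resp (colouring-pathVert S e t) (restrictToPath Sok e t)

  stateOk⇒proper : ∀ {S} → StateOk S → Proper (colouring S)
  stateOk⇒proper {S} Sok = lists , λ { x y (inj₁ edge) → edgeOk edge ; x y (inj₂ edge) → edgeOk edge ∘ sym }
    where
    open StateOk Sok
    pathOk : ∀ e t → IsLColoring PathAdj (pathLists e t) (colouring S ∘ pathVert E e t)
    pathOk e t = IsLColoring-resp (sym ∘ colouring-pathVert S e t) (proj₂ (gadget-ok e) t)
    lists : ∀ x → colouring S x ∈ L' IL x
    lists (orig w) = orig-ok w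
    lists (xv e) = proj₁ (proj₁ (gadget-ok e))
    lists (yv e) = proj₁ (proj₂ (proj₁ (gadget-ok e)))
    lists (zv e) = proj₁ (proj₂ (proj₂ (proj₁ (gadget-ok e))))
    lists (int e t j) = subst (λ x → colouring S x ∈ L' IL x) (pathVert-inner e t j) (proj₁ (pathOk e t) (inner j))
    lists va = proj₁ k-ok
    lists vb = proj₁ (proj₂ k-ok)
    lists vc = proj₁ (proj₂ (proj₂ k-ok))
    lists vd = proj₁ (proj₂ (proj₂ (proj₂ k-ok)))
    edgeOk : ∀ {x y} → Edge' E x y → colouring S x ≢ colouring S y
    edgeOk (ux e) with gadget-ok e
    ... | (_ , _ , _ , u≢x , _ , _) , _ = u≢x
    edgeOk (uy e) with gadget-ok e
    ... | (_ , _ , _ , _ , u≢y , _) , _ = u≢y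
    edgeOk (zc e) with gadget-ok e
    ... | (_ , _ , _ , _ , _ , z≢c) , _ = z≢c
    edgeOk (path e t i) = proj₂ (pathOk e t) (inject₁ i) (suc i) (inj₁ (cong suc (sym (Fin.toℕ-inject₁ i))))
    edgeOk ab with k-ok
    ... | _ , _ , _ , _ , a≢b , _ = a≢b
    edgeOk ac with k-ok
    ... | _ , _ , _ , _ , _ , a≢c , _ = a≢c
    edgeOk ad with k-ok
    ... | _ , _ , _ , _ , _ , _ , a≢d , _ = a≢d
    edgeOk bc with k-ok
    ... | _ , _ , _ , _ , _ , _ , _ , b≢c , _ = b≢c
    edgeOk bd with k-ok
    ... | _ , _ , _ , _ , _ , _ , _ , _ , b≢d = b≢d

  gadgetWalk : ∀ {e cu cv cc x y z ι ι'} → FrameOk cu cc x y z →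
    PathsOk e cu cv x y z ι → PathsOk e cu cv x y z ι' →
    (∀ t → Reach (PathOk (pathLists e t) (startColour cu cv x y t) (finishColour x y z t)) 5 (ι t) (ι' t)) →
    Reach (GadgetOk e cu cv cc) (8 * 5) (gadget x y z ι) (gadget x y z ι')
  gadgetWalk {x = x} {y} {z} frame =
    componentwise 8 (gadget x y z) gint gadget-cong gadget-agreeOff (frame ,_)

  edgesWalk : ∀ {o F F' k B} → KOk k → (∀ w → o w ∈ S123) →
    (∀ e → GadgetOk e (o (src e)) (o (dst e)) (k (suc (suc zero))) (F e)) →
    (∀ e → GadgetOk e (o (src e)) (o (dst e)) (k (suc (suc zero))) (F' e)) →
    (∀ e → Reach (GadgetOk e (o (src e)) (o (dst e)) (k (suc (suc zero)))) B (F e) (F' e)) →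
    Reach Proper (m * B) (colouring (state o F k)) (colouring (state o F' k))
  edgesWalk {o} {k = k} k-ok o-ok =
    componentwise m (λ F → colouring (state o F k)) gadgetVertex
      (λ F≗ → colouring-cong (λ _ → refl) F≗ (λ _ → refl))
      (λ same → colouring-agreeOff (λ _ _ → refl) same (λ _ _ → refl))
      (λ F-ok → stateOk⇒proper (record { k-ok = k-ok ; orig-ok = o-ok ; gadget-ok = F-ok }))

-- The recolouring schedule

asCol : Fin 3 → Col
asCol = inject₁

-- The colours x, y, z receive for an edge uv whose end u has colour asCol i: exactly one of x, y
-- leaves colour 4, no forbidden pair arises whatever colour v ≠ u has, and z avoids both 3 and 4,
-- which lets c switch to 4 later.
newX newY newZ : Fin 3 → Col
newX zero = c4
newX (suc zero) = c1
newX (suc (suc zero)) = c2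
newY zero = c3
newY (suc zero) = c4
newY (suc (suc zero)) = c4
newZ zero = c2
newZ (suc zero) = c1
newZ (suc (suc zero)) = c1

gadget-agreeOffEnds : ∀ {x y z x' y' z' ι w} →
  (gx ≢ w → x ≡ x') → (gy ≢ w → y ≡ y') → (gz ≢ w → z ≡ z') →
  AgreeOff (gadget x y z ι) (gadget x' y' z' ι) w
gadget-agreeOffEnds same-x same-y same-z gx = same-x
gadget-agreeOffEnds same-x same-y same-z gy = same-y
gadget-agreeOffEnds same-x same-y same-z gz = same-z
gadget-agreeOffEnds same-x same-y same-z (gint t j) _ = refl

moveXY : ∀ i {z ι} → Σ GadgetVertex (AgreeOff (gadget c4 c4 z ι) (gadget (newX i) (newY i) z ι))
moveXY zero = gy , gadget-agreeOffEnds (λ _ → refl) (λ ne → ⊥-elim (ne refl)) (λ _ → refl)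
moveXY (suc zero) = gx , gadget-agreeOffEnds (λ ne → ⊥-elim (ne refl)) (λ _ → refl) (λ _ → refl)
moveXY (suc (suc zero)) = gx , gadget-agreeOffEnds (λ ne → ⊥-elim (ne refl)) (λ _ → refl) (λ _ → refl)

startColour-between : ∀ {cu cv a b a' b' x y} → cu ≡ a ⊎ cu ≡ a' → cv ≡ b ⊎ cv ≡ b' → ∀ t →
  startColour cu cv x y t ≡ startColour a b x y t ⊎ startColour cu cv x y t ≡ startColour a' b' x y t
startColour-between hu hv zero = hu
startColour-between hu hv (suc zero) = hu
startColour-between hu hv (suc (suc zero)) = hu
startColour-between hu hv (suc (suc (suc zero))) = hv
startColour-between hu hv (suc (suc (suc (suc zero)))) = hv
startColour-between hu hv (suc (suc (suc (suc (suc zero))))) = hv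
startColour-between hu hv (suc (suc (suc (suc (suc (suc zero)))))) = inj₁ refl
startColour-between hu hv (suc (suc (suc (suc (suc (suc (suc zero))))))) = inj₁ refl

oneWayLength : ℕ → ℕ
oneWayLength m = m * (8 * 5) + m * 2 + m * (8 * 5 + (1 + (8 * 5 + 1)))

module Schedule {n m : ℕ} (E : Fin m → Fin n × Fin n) (IL : Fin m → Fin 8 → Fin 5 → Subset 4)
  (forbidding : ∀ e t → IsForbiddingPath (λ j → L' IL (pathVert E e t j)) (pathR t) (pathS t))
  (αI : Fin m → Fin 8 → Fin 5 → Col) (α-proper : IsLColoring (Adj' E) (L' IL) (α' αI))
  (f : Fin n → Fin 3) (f-proper : ∀ e → f (proj₁ (E e)) ≢ f (proj₂ (E e))) where

  open Construction E IL

  PathsOk-between : ∀ {e a b a' b' cu cv x y z ι} → PathsOk e a b x y z ι → PathsOk e a' b' x y z ι →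
    cu ≡ a ⊎ cu ≡ a' → cv ≡ b ⊎ cv ≡ b' → PathsOk e cu cv x y z ι
  PathsOk-between {e} {x = x} {y} {z} {ι} ok ok' hu hv t with startColour-between {x = x} {y} hu hv t
  ... | inj₁ eq = subst (λ c → PathOk (pathLists e t) c (finishColour x y z t) (ι t)) (sym eq) (ok t)
  ... | inj₂ eq = subst (λ c → PathOk (pathLists e t) c (finishColour x y z t) (ι t)) (sym eq) (ok' t)

  record GadgetRetargeting (e : Fin m) (cc cu cv x y z cu' cv' x' y' z' : Col) (ι : Fin 8 → Fin 5 → Col) : Set where
    field
      interiors′ : Fin 8 → Fin 5 → Col
      ok-new : PathsOk e cu' cv' x' y' z' interiors′
      ok-old : PathsOk e cu cv x y z interiors′
      walk : Reach (GadgetOk e cu cv cc) (8 * 5) (gadget x y z ι) (gadget x y z interiors′)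

  retargetGadget : ∀ {e cc cu cv x y z cu' cv' x' y' z' ι} → FrameOk cu cc x y z → PathsOk e cu cv x y z ι →
    (∀ t → Retargetable (pathLists e t) (pathR t) (pathS t) (startColour cu cv x y t) (finishColour x y z t)
                        (startColour cu' cv' x' y' t) (finishColour x' y' z' t)) →
    GadgetRetargeting e cc cu cv x y z cu' cv' x' y' z' ι
  retargetGadget {e} {cu = cu} {cv} {x} {y} {z} {cu'} {cv'} {x'} {y'} {z'} {ι} frame ι-ok allowed = record
    { interiors′ = interior′ ∘ retargeted
    ; ok-new = ok-new ∘ retargeted
    ; ok-old = ok-old ∘ retargeted
    ; walk = gadgetWalk frame ι-ok (ok-old ∘ retargeted) (walk ∘ retargeted)
    }
    where
    open Retargeting
    retargeted : ∀ t → Retargeting (pathLists e t) (startColour cu cv x y t) (finishColour x y z t)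
                                   (startColour cu' cv' x' y' t) (finishColour x' y' z' t) (ι t)
    retargeted t = retarget (forbidding e t) (ι-ok t) (allowed t)

  open GadgetRetargeting

  g : Fin n → Col
  g = asCol ∘ f

  asCol∈S123 : ∀ i → asCol i ∈ S123
  asCol∈S123 = toWitness {a? = all? λ i → asCol i ∈? S123} _

  c1∈S123 : c1 ∈ S123
  c1∈S123 = asCol∈S123 zero

  frame-prepared : ∀ cu → cu ∈ S123 → FrameOk cu c3 c4 c4 c4
  frame-prepared = toWitness {a? = all? λ cu → cu ∈? S123 →-dec frameOk? cu c3 c4 c4 c4} _

  frame-xy : ∀ i → FrameOk (asCol i) c3 (newX i) (newY i) c4
  frame-xy = toWitness {a? = all? λ i → frameOk? (asCol i) c3 (newX i) (newY i) c4} _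

  frame-z : ∀ i cc → cc ∈ S34 → FrameOk (asCol i) cc (newX i) (newY i) (newZ i)
  frame-z =
    toWitness {a? = all? λ i → all? λ cc → cc ∈? S34 →-dec frameOk? (asCol i) cc (newX i) (newY i) (newZ i)} _

  allowed-prepare : ∀ e i j t → Retargetable (pathLists e t) (pathR t) (pathS t)
    (startColour c1 c1 c4 c4 t) (finishColour c4 c4 c4 t)
    (startColour (asCol i) (asCol j) c4 c4 t) (finishColour c4 c4 c4 t)
  allowed-prepare e = toWitness {a? = all? λ i → all? λ j → all? λ t →
    retargetable? (pathLists e t) (pathR t) (pathS t) _ _ _ _} _

  allowed-xy : ∀ e i j → i ≢ j → ∀ t → Retargetable (pathLists e t) (pathR t) (pathS t)
    (startColour (asCol i) (asCol j) c4 c4 t) (finishColour c4 c4 c4 t)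
    (startColour (asCol i) (asCol j) (newX i) (newY i) t) (finishColour (newX i) (newY i) c4 t)
  allowed-xy e = toWitness {a? = all? λ i → all? λ j → ¬? (i Fin.≟ j) →-dec all? λ t →
    retargetable? (pathLists e t) (pathR t) (pathS t) _ _ _ _} _

  allowed-z : ∀ e i j → i ≢ j → ∀ t → Retargetable (pathLists e t) (pathR t) (pathS t)
    (startColour (asCol i) (asCol j) (newX i) (newY i) t) (finishColour (newX i) (newY i) c4 t)
    (startColour (asCol i) (asCol j) (newX i) (newY i) t) (finishColour (newX i) (newY i) (newZ i) t)
  allowed-z e = toWitness {a? = all? λ i → all? λ j → ¬? (i Fin.≟ j) →-dec all? λ t →
    retargetable? (pathLists e t) (pathR t) (pathS t) _ _ _ _} _

  kColours : Col → Col → Fin 4 → Col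
  kColours a b = a ∷ b ∷ c3 ∷ c4 ∷ []

  αGadget : Fin m → GadgetVertex → Col
  αGadget e = gadget c4 c4 c4 (αI e)

  initialState : Col → Col → State n m
  initialState a b = state (λ _ → c1) αGadget (kColours a b)

  α-colouring : α' αI ≗ colouring (initialState c1 c2)
  α-colouring = λ { (orig _) → refl ; (xv _) → refl ; (yv _) → refl ; (zv _) → refl ; (int _ _ _) → refl
                  ; va → refl ; vb → refl ; vc → refl ; vd → refl }

  β-colouring : colouring (initialState c2 c1) ≗ β' αI
  β-colouring = λ { (orig _) → refl ; (xv _) → refl ; (yv _) → refl ; (zv _) → refl ; (int _ _ _) → refl
                  ; va → refl ; vb → refl ; vc → refl ; vd → refl }

  αPaths : ∀ e → PathsOk e c1 c1 c4 c4 c4 (αI e)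
  αPaths = gadgetOk-paths (IsLColoring-resp α-colouring α-proper)

  initialState-ok : ∀ a b → KOk (kColours a b) → StateOk (initialState a b)
  initialState-ok a b k-ok = record
    { k-ok = k-ok ; orig-ok = λ _ → c1∈S123 ; gadget-ok = λ e → frame-prepared c1 c1∈S123 , αPaths e }

  prepared : ∀ e → GadgetRetargeting e c3 c1 c1 c4 c4 c4 (g (src e)) (g (dst e)) c4 c4 c4 (αI e)
  prepared e = retargetGadget (frame-prepared c1 c1∈S123) (αPaths e) (allowed-prepare e (f (src e)) (f (dst e)))

  preparedGadget : Fin m → GadgetVertex → Col
  preparedGadget e = gadget c4 c4 c4 (interiors′ (prepared e))

  Painting : (Fin n → Col) → Set
  Painting o = ∀ w → o w ≡ c1 ⊎ o w ≡ g w

  Painting-∈ : ∀ {o} → Painting o → ∀ w → o w ∈ S123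
  Painting-∈ p w with p w
  ... | inj₁ eq = subst (_∈ S123) (sym eq) (c1∈S123)
  ... | inj₂ eq = subst (_∈ S123) (sym eq) (asCol∈S123 (f w))

  preparedGadget-ok : ∀ e {cu cv} → cu ≡ c1 ⊎ cu ≡ g (src e) → cv ≡ c1 ⊎ cv ≡ g (dst e) →
    GadgetOk e cu cv c3 (preparedGadget e)
  preparedGadget-ok e {cu} hu hv =
    frame-prepared cu (c1-or-g∈ hu) , PathsOk-between (ok-old (prepared e)) (ok-new (prepared e)) hu hv
    where
    c1-or-g∈ : ∀ {c} → c ≡ c1 ⊎ c ≡ g (src e) → c ∈ S123
    c1-or-g∈ (inj₁ refl) = c1∈S123
    c1-or-g∈ (inj₂ refl) = asCol∈S123 (f (src e))

  paint : Fin n → (Fin n → Col) → Fin n → Col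
  paint w o = updateAt o w (λ _ → g w)

  paintAll : ∀ {k} → Vec (Fin m) k → (Fin n → Col) → Fin n → Col
  paintAll Vec.[] o = o
  paintAll (e Vec.∷ es) o = paintAll es (paint (dst e) (paint (src e) o))

  painted : Fin n → Col
  painted = paintAll (allFin m) (λ _ → c1)

  paint-painting : ∀ {o} w → Painting o → Painting (paint w o)
  paint-painting {o} w p w' with w' Fin.≟ w
  ... | yes refl = inj₂ (updateAt-updates w o)
  ... | no w'≢w rewrite updateAt-minimal w' w {λ _ → g w} o w'≢w = p w'

  paint-keeps : ∀ {o w'} w → o w' ≡ g w' → paint w o w' ≡ g w'
  paint-keeps {o} {w'} w painted-w' with w' Fin.≟ w
  ... | yes refl = updateAt-updates w o
  ... | no w'≢w = trans (updateAt-minimal w' w o w'≢w) painted-w'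

  paintAll-keeps : ∀ {k} (es : Vec (Fin m) k) {o w} → o w ≡ g w → paintAll es o w ≡ g w
  paintAll-keeps Vec.[] painted-w = painted-w
  paintAll-keeps (e Vec.∷ es) painted-w = paintAll-keeps es (paint-keeps (dst e) (paint-keeps (src e) painted-w))

  paintAll-paints : ∀ {k} {es : Vec (Fin m) k} {e} o → e ∈ᵥ es →
    paintAll es o (src e) ≡ g (src e) × paintAll es o (dst e) ≡ g (dst e)
  paintAll-paints {es = e Vec.∷ es} o (here refl) =
    paintAll-keeps es (paint-keeps (dst e) (updateAt-updates (src e) o)) ,
    paintAll-keeps es (updateAt-updates (dst e) _)
  paintAll-paints {es = e' Vec.∷ es} o (there e∈es) = paintAll-paints _ e∈es

  painted-src : ∀ e → painted (src e) ≡ g (src e)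
  painted-src e = proj₁ (paintAll-paints _ (∈-allFin⁺ e))

  painted-dst : ∀ e → painted (dst e) ≡ g (dst e)
  painted-dst e = proj₂ (paintAll-paints _ (∈-allFin⁺ e))

  painted-painting : Painting painted
  painted-painting = paintAll-painting (allFin m) (λ _ → inj₁ refl)
    where
    paintAll-painting : ∀ {k} (es : Vec (Fin m) k) {o} → Painting o → Painting (paintAll es o)
    paintAll-painting Vec.[] p = p
    paintAll-painting (e Vec.∷ es) p = paintAll-painting es (paint-painting (dst e) (paint-painting (src e) p))

  paintingWalk : ∀ a b → KOk (kColours a b) → ∀ {k} (es : Vec (Fin m) k) {o} → Painting o →
    Reach Proper (k * 2) (colouring (state o preparedGadget (kColours a b)))
                         (colouring (state (paintAll es o) preparedGadget (kColours a b)))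
  paintingWalk a b k-ok Vec.[] p = Reach-refl
  paintingWalk a b k-ok (e Vec.∷ es) p =
    paintStep (src e) p ⟫ paintStep (dst e) (paint-painting (src e) p)
    ⟫ paintingWalk a b k-ok es (paint-painting (dst e) (paint-painting (src e) p))
    where
    paintStep : ∀ w {o} → Painting o → Reach Proper 1 (colouring (state o preparedGadget (kColours a b)))
                                                      (colouring (state (paint w o) preparedGadget (kColours a b)))
    paintStep w {o} p = Reach-single (orig w)
      (colouring-agreeOff (λ w' ne → sym (updateAt-minimal w' w o (ne ∘ cong orig)))
                          (λ _ _ _ → refl) (λ _ _ → refl))
      (stateOk⇒proper (record
        { k-ok = k-ok ; orig-ok = Painting-∈ p' ; gadget-ok = λ e → preparedGadget-ok e (p' (src e)) (p' (dst e)) }))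
      where
      p' = paint-painting w p

  recolourOriginals : ∀ a b → KOk (kColours a b) →
    Reach Proper (m * (8 * 5) + m * 2) (colouring (initialState a b)) (colouring (state painted preparedGadget (kColours a b)))
  recolourOriginals a b k-ok =
    edgesWalk k-ok (λ _ → c1∈S123) (StateOk.gadget-ok (initialState-ok a b k-ok))
      (λ e → preparedGadget-ok e (inj₁ refl) (inj₁ refl)) (walk ∘ prepared)
    ⟫ paintingWalk a b k-ok (allFin m) (λ _ → inj₁ refl)

  3∈34 : c3 ∈ S34
  3∈34 = toWitness {a? = c3 ∈? S34} _

  Finishing : Fin m → (cu cv : Col) → (GadgetVertex → Col) → Set
  Finishing e cu cv G₀ = Σ (GadgetVertex → Col) λ G →
    Reach (GadgetOk e cu cv c3) (8 * 5 + (1 + (8 * 5 + 1))) G₀ G × (∀ cc → cc ∈ S34 → GadgetOk e cu cv cc G)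

  finishGadget : ∀ e i j → i ≢ j → ∀ {ι} → PathsOk e (asCol i) (asCol j) c4 c4 c4 ι →
    Finishing e (asCol i) (asCol j) (gadget c4 c4 c4 ι)
  finishGadget e i j i≢j {ι} ι-ok =
    gadget (newX i) (newY i) (newZ i) (interiors′ C) ,
    walk B ⟫ Reach-single (proj₁ (moveXY i)) (proj₂ (moveXY i)) (frame-xy i , ok-new B)
      ⟫ walk C ⟫ Reach-single gz (gadget-agreeOffEnds (λ _ → refl) (λ _ → refl) (λ ne → ⊥-elim (ne refl)))
                   (frame-z i c3 3∈34 , ok-new C) ,
    λ cc cc∈ → frame-z i cc cc∈ , ok-new C
    where
    B : GadgetRetargeting e c3 (asCol i) (asCol j) c4 c4 c4 (asCol i) (asCol j) (newX i) (newY i) c4 ι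
    B = retargetGadget (frame-prepared (asCol i) (asCol∈S123 i)) ι-ok (allowed-xy e i j i≢j)
    C : GadgetRetargeting e c3 (asCol i) (asCol j) (newX i) (newY i) c4 (asCol i) (asCol j) (newX i) (newY i) (newZ i)
          (interiors′ B)
    C = retargetGadget (frame-xy i) (ok-new B) (allowed-z e i j i≢j)

  finished : ∀ e → Finishing e (painted (src e)) (painted (dst e)) (preparedGadget e)
  finished e = subst₂ (λ cu cv → Finishing e cu cv (preparedGadget e)) (sym (painted-src e)) (sym (painted-dst e))
    (finishGadget e (f (src e)) (f (dst e)) (f-proper e) (ok-new (prepared e)))

  finalGadget : Fin m → GadgetVertex → Col
  finalGadget e = proj₁ (finished e)

  recolourGadgets : ∀ a b → KOk (kColours a b) →
    Reach Proper (m * (8 * 5 + (1 + (8 * 5 + 1)))) (colouring (state painted preparedGadget (kColours a b)))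
                                                   (colouring (state painted finalGadget (kColours a b)))
  recolourGadgets a b k-ok =
    edgesWalk k-ok (Painting-∈ painted-painting)
      (λ e → preparedGadget-ok e (inj₂ (painted-src e)) (inj₂ (painted-dst e)))
      (λ e → proj₂ (proj₂ (finished e)) c3 3∈34) (proj₁ ∘ proj₂ ∘ finished)

  finalState-ok : ∀ k → KOk k → StateOk (state painted finalGadget k)
  finalState-ok k k-ok = record
    { k-ok = k-ok ; orig-ok = Painting-∈ painted-painting
    ; gadget-ok = λ e → proj₂ (proj₂ (finished e)) _ (proj₁ (proj₂ (proj₂ k-ok))) }

  kStep : ∀ k k' i → {True (kOk? k')} → {True (all? λ i' → ¬? (i' Fin.≟ i) →-dec k i' Fin.≟ k' i')} →
    Reach Proper 1 (colouring (state painted finalGadget k)) (colouring (state painted finalGadget k'))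
  kStep k k' i {k'-ok} {same} =
    Reach-single (kVertex i)
      (colouring-agreeOff (λ _ _ → refl) (λ _ _ _ → refl) (λ i' ne → toWitness same i' (ne ∘ cong kVertex)))
      (stateOk⇒proper (finalState-ok k' (toWitness k'-ok)))

  -- Once every z avoids 4, c can move to 4, which frees colour 3 for a while a and b swap.
  swapAB : Reach Proper 5 (colouring (state painted finalGadget (kColours c1 c2)))
                          (colouring (state painted finalGadget (kColours c2 c1)))
  swapAB =
    kStep (kColours c1 c2) (c1 ∷ c2 ∷ c4 ∷ c4 ∷ []) (suc (suc zero))
    ⟫ kStep (c1 ∷ c2 ∷ c4 ∷ c4 ∷ []) (c3 ∷ c2 ∷ c4 ∷ c4 ∷ []) zero
    ⟫ kStep (c3 ∷ c2 ∷ c4 ∷ c4 ∷ []) (c3 ∷ c1 ∷ c4 ∷ c4 ∷ []) (suc zero)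
    ⟫ kStep (c3 ∷ c1 ∷ c4 ∷ c4 ∷ []) (c2 ∷ c1 ∷ c4 ∷ c4 ∷ []) zero
    ⟫ kStep (c2 ∷ c1 ∷ c4 ∷ c4 ∷ []) (kColours c2 c1) (suc (suc zero))

  toFinal : ∀ a b → KOk (kColours a b) →
    Reach Proper (oneWayLength m)
      (colouring (initialState a b)) (colouring (state painted finalGadget (kColours a b)))
  toFinal a b k-ok = recolourOriginals a b k-ok ⟫ recolourGadgets a b k-ok

  recolouring : Reach Proper (oneWayLength m + (5 + oneWayLength m)) (α' αI) (β' αI)
  recolouring =
    Reach-cast α-colouring β-colouring
      (toFinal c1 c2 k-ok₁₂ ⟫ swapAB
         ⟫ Reach-reverse (stateOk⇒proper (initialState-ok c2 c1 k-ok₂₁)) (toFinal c2 c1 k-ok₂₁))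
    where
    k-ok₁₂ : KOk (kColours c1 c2)
    k-ok₁₂ = toWitness {a? = kOk? (kColours c1 c2)} _
    k-ok₂₁ : KOk (kColours c2 c1)
    k-ok₂₁ = toWitness {a? = kOk? (kColours c2 c1)} _

recolouring-length : ∀ m → 1 ≤ m → oneWayLength m + (5 + oneWayLength m) ≤ 253 * m
recolouring-length m 1≤m = begin
  oneWayLength m + (5 + oneWayLength m) ≡⟨ normalise m ⟩
  248 * m + 5       ≤⟨ ℕ.+-monoʳ-≤ (248 * m) (ℕ.*-monoʳ-≤ 5 1≤m) ⟩
  248 * m + 5 * 1 * m ≡⟨ sym (ℕ.*-distribʳ-+ m 248 (5 * 1)) ⟩
  253 * m           ∎
  where
  open ℕ.≤-Reasoning
  normalise : ∀ m → m * (8 * 5) + m * 2 + m * (8 * 5 + (1 + (8 * 5 + 1))) +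
                      (5 + (m * (8 * 5) + m * 2 + m * (8 * 5 + (1 + (8 * 5 + 1))))) ≡ 248 * m + 5
  normalise = solve-∀

mainTheorem9 : Σ ℕ λ C →
    ∀ (n m : ℕ) → 1 ≤ m →
    (E : Fin m → Fin n × Fin n) → IsSimpleEdgeFamily E →
    (IL : Fin m → Fin 8 → Fin 5 → Subset 4) →
    (∀ e t → IsForbiddingPath (λ j → L' IL (pathVert E e t j)) (pathR t) (pathS t)) →
    (αI : Fin m → Fin 8 → Fin 5 → Col) →
    IsLColoring (Adj' E) (L' IL) (α' αI) →
    ThreeColorable E →
    Σ ℕ λ k → k ≤ C * m × Σ (RecoloringSeq (Adj' E) (L' IL) k) λ S →
      (∀ w → col S zero w ≡ α' αI w)
      × (∀ w → col S (fromℕ k) w ≡ β' αI w)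
mainTheorem9 = 253 , λ n m 1≤m E _ IL forbidding αI α-proper (f , f-proper) →
  let (k , k≤ , W) = Schedule.recolouring E IL forbidding αI α-proper f f-proper
      (S , S₀ , Sₖ) = toRecoloringSeq α-proper W
  in k , ℕ.≤-trans k≤ (recolouring-length m 1≤m) , S , S₀ , Sₖ
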